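{- Let $n\ge 3$ and let $C_n$ be the cycle graph with vertices $v_1,\ldots,v_n$ (edges $\{v_j,v_{j+1}\}$ for $1\le j<n$ and $\{v_n,v_1\}$). Let $S\subseteq V(C_n)$ be $C_n$-admissible, i.e. $P(S;C_n)\neq\emptyset$. For each $v_i\in S$ put $\widehat{S_i}=S\setminus\{v_i\}$, and let $C_n\setminus\{v_i\}$ denote the graph obtained from $C_n$ by deleting $v_i$ and its incident edges (a path graph on $n-1$ vertices). Then \[ |P(S;C_n)| = \sum_{v_i\in S} \big|P(\widehat{S_i};\, C_n\setminus\{v_i\})\big|. \]
   Context: For a finite simple graph $G$ with $N$ vertices, a labeling is a bijection $\ell:V(G)\to\{1,\ldots,N\}$. The labeling has a peak at a vertex $v$ if $\deg_G(v)\ge 2$ and $\ell(v)>\ell(w)$ for every neighbor $w$ of $v$ (vertices of degree $0$ or $1$ are never peaks). The peak set of $\ell$ is the set of vertices at which $\ell$ has a peak. For $S\subseteq V(G)$, $P(S;G)$ denotes the set of labelings of $G$ whose peak set is exactly $S$. -}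

module Defs where

open import Data.Bool using (Bool; true; false; _∨_; if_then_else_)
open import Data.Nat using (ℕ; zero; suc; _≤_; _%_)
import Data.Nat as ℕ
open import Data.Fin using (Fin; toℕ; punchIn; _<_; _≟_; _<?_)
open import Data.Fin.Properties using (all?)
open import Data.Fin.Subset using (Subset; ∣_∣)
open import Data.Vec using (Vec; []; _∷_; lookup; tabulate)
open import Data.Vec.Properties using (≡-dec)
open import Data.Nat.ListAction using (sum)
open import Data.List using (List; [_]; map; concatMap; allFin; filter; length)
open import Data.Product using (_×_; Σ; _,_)
open import Relation.Binary.PropositionalEquality using (_≡_)
open import Relation.Nullary using (Dec; ⌊_⌋; yes; no)
open import Relation.Nullary.Decidable using (_→-dec_; _×-dec_)
import Data.Bool.Properties as BoolP

record Graph (N : ℕ) : Set where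
  field
    adj : Fin N → Fin N → Bool
open Graph public

deg : ∀ {N} → Graph N → Fin N → ℕ
deg G v = ∣ tabulate (adj G v) ∣

-- A labeling candidate: ℓ assigns to vertex v the label lookup ℓ v ∈ Fin N
-- (Fin N = {0,…,N-1} stands for {1,…,N}, order-preservingly).
IsLabeling : ∀ {N} → Vec (Fin N) N → Set
IsLabeling ℓ = ∀ i j → lookup ℓ i ≡ lookup ℓ j → i ≡ j

isLabeling? : ∀ {N} (ℓ : Vec (Fin N) N) → Dec (IsLabeling ℓ)
isLabeling? ℓ = all? λ i → all? λ j → (lookup ℓ i ≟ lookup ℓ j) →-dec (i ≟ j)

IsPeak : ∀ {N} → Graph N → Vec (Fin N) N → Fin N → Set
IsPeak G ℓ v = (2 ≤ deg G v) × (∀ w → adj G v w ≡ true → lookup ℓ w < lookup ℓ v)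

isPeak? : ∀ {N} (G : Graph N) (ℓ : Vec (Fin N) N) v → Dec (IsPeak G ℓ v)
isPeak? G ℓ v = (2 ℕ.≤? deg G v) ×-dec
  (all? λ w → (adj G v w BoolP.≟ true) →-dec (lookup ℓ w <? lookup ℓ v))

peakSet : ∀ {N} → Graph N → Vec (Fin N) N → Subset N
peakSet G ℓ = tabulate λ v → ⌊ isPeak? G ℓ v ⌋

InP : ∀ {N} → Subset N → Graph N → Vec (Fin N) N → Set
InP S G ℓ = IsLabeling ℓ × (peakSet G ℓ ≡ S)

inP? : ∀ {N} (S : Subset N) (G : Graph N) ℓ → Dec (InP S G ℓ)
inP? S G ℓ = isLabeling? ℓ ×-dec ≡-dec BoolP._≟_ (peakSet G ℓ) S

allVecs : ∀ N {k} → List (Vec (Fin k) N)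
allVecs zero = [ [] ]
allVecs (suc N) {k} = concatMap (λ x → map (x ∷_) (allVecs N)) (allFin k)

numP : ∀ {N} → Subset N → Graph N → ℕ
numP {N} S G = length (filter (inP? S G) (allVecs N))

Admissible : ∀ {N} → Subset N → Graph N → Set
Admissible {N} S G = Σ (Vec (Fin N) N) (InP S G)

-- cycle C_n with n = suc m; vertex v_k is index k-1; v_j ~ v_{j+1 mod n}
cycle : ∀ m → Graph (suc m)
cycle m = record { adj = λ i j →
  ⌊ toℕ j ℕ.≟ suc (toℕ i) % suc m ⌋ ∨ ⌊ toℕ i ℕ.≟ suc (toℕ j) % suc m ⌋ }

deleteV : ∀ {m} → Graph (suc m) → Fin (suc m) → Graph m
deleteV G i = record { adj = λ x y → adj G (punchIn i x) (punchIn i y) }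

deleteS : ∀ {m} → Subset (suc m) → Fin (suc m) → Subset m
deleteS S i = tabulate λ x → lookup S (punchIn i x)

sumFin : ∀ n → (Fin n → ℕ) → ℕ
sumFin n f = sum (map f (allFin n))

-- In any labeling ℓ of C_n the vertex i carrying the largest label is a peak, and
-- deleting it yields a labeling ℓ' of the path C_n \ {i} (relabel 1..n-1).  Peaks away from i
-- are unaffected: a neighbour of i is a peak neither in C_n (it lies below ℓ(i)) nor in
-- C_n \ {i} (its degree drops to 1), and every other vertex keeps its neighbourhood.  Hence
-- ℓ ↦ (i , ℓ') is a bijection from P(S;C_n) onto the pairs with i ∈ S and
-- ℓ' ∈ P(S \ {i}; C_n \ {i}); the inverse inserts the top label at i.
--
-- The argument only uses that every vertex has degree 2 and no loop, so the identity is proved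
-- for every such graph and specialised to cycles at the end.
module Submission where

open import Defs
open import Data.Bool using (Bool; true; false; if_then_else_; _∨_; _≟_)
open import Data.Bool.Properties using (¬-not)
open import Data.Nat using (ℕ; zero; suc; _≤_; _+_; _%_; z≤n; s≤s)
import Data.Nat as ℕ
import Data.Nat.Properties as ℕP
open import Data.Nat.DivMod using (m%n<n; m<n⇒m%n≡m; n%n≡0)
open import Data.Nat.ListAction using (sum)
open import Data.Fin as Fin using (Fin; toℕ; fromℕ; fromℕ<; inject₁; lower₁; punchIn; punchOut; _<_)
open import Data.Fin.Properties as FinP
  using (toℕ-injective; toℕ-fromℕ; toℕ-fromℕ<; toℕ-inject₁; toℕ<n; inject₁-injective; inject₁-lower₁;
         fromℕ≢inject₁; punchInᵢ≢i; punchIn-punchOut; punchOut-injective; pigeonhole; any?)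
open import Data.Fin.Subset using (Subset; ∣_∣)
open import Data.Vec as Vec using (Vec; []; _∷_; lookup; tabulate; insertAt)
open import Data.Vec.Properties
  using (∷-injective; lookup∘tabulate; tabulate∘lookup; tabulate-cong; insertAt-lookup; insertAt-punchIn; lookup-map)
open import Data.List using (List; []; _∷_; length; filter; map; _++_; concatMap; allFin; cartesianProduct; cartesianProductWith)
open import Data.List.Properties using (length-map; length-++; filter-++; filter-≐; filter-none; map-cong)
open import Data.List.Membership.Propositional using (_∈_)
open import Data.List.Membership.Propositional.Properties
  using (∈-map⁺; ∈-map⁻; ∈-filter⁺; ∈-filter⁻; ∈-allFin; ∈-cartesianProductWith⁺; ∈-cartesianProduct⁺)
open import Data.List.Membership.Propositional.Properties.WithK using (unique∧set⇒bag)
open import Data.List.Relation.Binary.BagAndSetEquality using (∼bag⇒↭; _∼[_]_; set)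
open import Data.List.Relation.Binary.Permutation.Propositional.Properties using (↭-length)
open import Data.List.Relation.Unary.Any using (here)
import Data.List.Relation.Unary.All as All
open import Data.List.Relation.Unary.AllPairs using ([]; _∷_)
open import Data.List.Relation.Unary.Unique.Propositional using (Unique)
import Data.List.Relation.Unary.Unique.Propositional.Properties as Unique
open import Data.Product using (∃; ∃₂; _×_; _,_; proj₁; proj₂; uncurry)
open import Data.Sum using (_⊎_; inj₁; inj₂)
import Data.Sum as Sum
open import Data.Empty using (⊥; ⊥-elim)
open import Function using (_∘_; id; _⇔_; mk⇔; Equivalence)
open import Relation.Nullary using (Dec; yes; no; ⌊_⌋; contradiction)
open import Relation.Nullary.Decidable using (isYes≗does; dec-true; does-⇔; _×-dec_)
open import Relation.Unary using (Decidable)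
open import Relation.Binary.PropositionalEquality

open Equivalence using (to; from)

-- If g maps the Q-elements of a complete duplicate-free listing ys injectively onto the
-- P-elements of a complete duplicate-free listing xs, both filtered listings have the same
-- length: the image list and the P-filter are duplicate-free with the same members.
count-image : {A B : Set} {P : A → Set} {Q : B → Set} (P? : Decidable P) (Q? : Decidable Q)
  {xs : List A} {ys : List B} → Unique xs → Unique ys → (∀ a → a ∈ xs) → (∀ b → b ∈ ys) →
  (g : B → A) → (∀ {b c} → g b ≡ g c → b ≡ c) →
  (∀ {b} → Q b → P (g b)) → (∀ {a} → P a → ∃ λ b → Q b × g b ≡ a) →
  length (filter P? xs) ≡ length (filter Q? ys)
count-image P? Q? {xs} {ys} xs! ys! xs-all ys-all g g-inj Q⇒P P⇒Q =
  trans (↭-length (∼bag⇒↭ (unique∧set⇒bag (Unique.filter⁺ P? xs!) image! same-members)))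
        (length-map g (filter Q? ys))
  where
  image! : Unique (map g (filter Q? ys))
  image! = Unique.map⁺ g-inj (Unique.filter⁺ Q? ys!)

  to-image : ∀ {a} → a ∈ filter P? xs → a ∈ map g (filter Q? ys)
  to-image a∈ with b , Qb , refl ← P⇒Q (proj₂ (∈-filter⁻ P? {xs = xs} a∈)) =
    ∈-map⁺ g (∈-filter⁺ Q? (ys-all b) Qb)

  from-image : ∀ {a} → a ∈ map g (filter Q? ys) → a ∈ filter P? xs
  from-image a∈ with b , b∈ , refl ← ∈-map⁻ g a∈ =
    ∈-filter⁺ P? (xs-all _) (Q⇒P (proj₂ (∈-filter⁻ Q? {xs = ys} b∈)))

  same-members : filter P? xs ∼[ set ] map g (filter Q? ys)
  same-members = mk⇔ to-image from-image

count-map : {A B : Set} {Q : B → Set} (Q? : Decidable Q) (h : A → B) (xs : List A) →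
  length (filter Q? (map h xs)) ≡ length (filter (λ x → Q? (h x)) xs)
count-map Q? h [] = refl
count-map Q? h (x ∷ xs) with Q? (h x)
... | yes _ = cong suc (count-map Q? h xs)
... | no _ = count-map Q? h xs

count-cartesianProduct : {A B : Set} {Q : A × B → Set} (Q? : Decidable Q) (xs : List A) (ys : List B) →
  length (filter Q? (cartesianProduct xs ys)) ≡ sum (map (λ x → length (filter (λ y → Q? (x , y)) ys)) xs)
count-cartesianProduct Q? [] ys = refl
count-cartesianProduct Q? (x ∷ xs) ys = begin
  length (filter Q? (map (x ,_) ys ++ cartesianProduct xs ys))
    ≡⟨ cong length (filter-++ Q? (map (x ,_) ys) _) ⟩
  length (filter Q? (map (x ,_) ys) ++ filter Q? (cartesianProduct xs ys))
    ≡⟨ length-++ (filter Q? (map (x ,_) ys)) ⟩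
  length (filter Q? (map (x ,_) ys)) + length (filter Q? (cartesianProduct xs ys))
    ≡⟨ cong₂ _+_ (count-map Q? (x ,_) ys) (count-cartesianProduct Q? xs ys) ⟩
  length (filter (λ y → Q? (x , y)) ys) + sum (map (λ x → length (filter (λ y → Q? (x , y)) ys)) xs)
    ∎
  where open ≡-Reasoning

allVecs-suc : ∀ N {k} → allVecs (suc N) {k} ≡ cartesianProductWith _∷_ (allFin k) (allVecs N)
allVecs-suc N {k} = concatMap-as-product (allFin k)
  where
  concatMap-as-product : (xs : List (Fin k)) →
    concatMap (λ x → map (x ∷_) (allVecs N)) xs ≡ cartesianProductWith _∷_ xs (allVecs N)
  concatMap-as-product [] = refl
  concatMap-as-product (x ∷ xs) = cong (map (x ∷_) (allVecs N) ++_) (concatMap-as-product xs)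

allVecs-complete : ∀ N {k} (v : Vec (Fin k) N) → v ∈ allVecs N
allVecs-complete zero [] = here refl
allVecs-complete (suc N) (x ∷ v) = subst (x ∷ v ∈_) (sym (allVecs-suc N))
  (∈-cartesianProductWith⁺ _∷_ (∈-allFin x) (allVecs-complete N v))

allVecs-unique : ∀ N {k} → Unique (allVecs N {k})
allVecs-unique zero = All.[] ∷ []
allVecs-unique (suc N) {k} = subst Unique (sym (allVecs-suc N))
  (Unique.cartesianProductWith⁺ _∷_ ∷-injective (Unique.allFin⁺ k) (allVecs-unique N))

fin-split : ∀ {m} (i w : Fin (suc m)) → w ≡ i ⊎ ∃ λ y → w ≡ punchIn i y
fin-split i w with i Fin.≟ w
... | yes i≡w = inj₁ (sym i≡w)
... | no i≢w = inj₂ (punchOut i≢w , sym (punchIn-punchOut i≢w))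

≡-via-lookup : ∀ {A : Set} {n} {a b : Vec A n} → (∀ w → lookup a w ≡ lookup b w) → a ≡ b
≡-via-lookup {a = a} {b} same = trans (sym (tabulate∘lookup a)) (trans (tabulate-cong same) (tabulate∘lookup b))

≡-via-punchIn : ∀ {A : Set} {m} (i : Fin (suc m)) {a b : Vec A (suc m)} →
  lookup a i ≡ lookup b i → (∀ x → lookup a (punchIn i x) ≡ lookup b (punchIn i x)) → a ≡ b
≡-via-punchIn i {a} {b} at-i elsewhere = ≡-via-lookup same
  where
  same : ∀ w → lookup a w ≡ lookup b w
  same w with fin-split i w
  ... | inj₁ refl = at-i
  ... | inj₂ (y , refl) = elsewhere y

-- An injective map Fin n → Fin n is surjective: a missed value would, after punchOut, give an
-- injective map Fin (suc m) → Fin m, contradicting the pigeonhole principle.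
injective⇒surjective : ∀ {n} (f : Fin n → Fin n) → (∀ i j → f i ≡ f j → i ≡ j) → ∀ y → ∃ λ i → f i ≡ y
injective⇒surjective {suc m} f f-inj y with any? (λ i → f i Fin.≟ y)
... | yes hit = hit
... | no missed = ⊥-elim (FinP.<⇒≢ i<j (f-inj i j (punchOut-injective (misses i) (misses j) collide)))
  where
  misses : ∀ i → y ≢ f i
  misses i y≡fi = missed (i , sym y≡fi)
  squeeze : Fin (suc m) → Fin m
  squeeze i = punchOut (misses i)
  i = proj₁ (pigeonhole (ℕP.n<1+n m) squeeze)
  j = proj₁ (proj₂ (pigeonhole (ℕP.n<1+n m) squeeze))
  i<j = proj₁ (proj₂ (proj₂ (pigeonhole (ℕP.n<1+n m) squeeze)))
  collide = proj₂ (proj₂ (proj₂ (pigeonhole (ℕP.n<1+n m) squeeze)))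

inject₁-<⇔ : ∀ {m} (a b : Fin m) → inject₁ a < inject₁ b ⇔ a < b
inject₁-<⇔ a b = mk⇔ (subst₂ ℕ._<_ (toℕ-inject₁ a) (toℕ-inject₁ b))
                     (subst₂ ℕ._<_ (sym (toℕ-inject₁ a)) (sym (toℕ-inject₁ b)))

inject₁<fromℕ : ∀ {m} (a : Fin m) → inject₁ a < fromℕ m
inject₁<fromℕ {m} a = subst₂ ℕ._<_ (sym (toℕ-inject₁ a)) (sym (toℕ-fromℕ m)) (toℕ<n a)

⌊⌋-⇔ : ∀ {A B : Set} (a? : Dec A) (b? : Dec B) → A ⇔ B → ⌊ a? ⌋ ≡ ⌊ b? ⌋
⌊⌋-⇔ a? b? A⇔B = trans (isYes≗does a?) (trans (does-⇔ A⇔B a? b?) (sym (isYes≗does b?)))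

⌊⌋-true : ∀ {A : Set} (a? : Dec A) → A → ⌊ a? ⌋ ≡ true
⌊⌋-true a? a = trans (isYes≗does a?) (dec-true a? a)

count-punchIn : ∀ {n} (f : Fin (suc n) → Bool) i →
  ∣ tabulate f ∣ ≡ (if f i then 1 else 0) + ∣ tabulate (f ∘ punchIn i) ∣
count-punchIn f Fin.zero with f Fin.zero
... | true = refl
... | false = refl
count-punchIn {suc n} f (Fin.suc i) with count-punchIn (f ∘ Fin.suc) i
... | ih with f Fin.zero | f (Fin.suc i)
... | true | true = cong suc ih
... | true | false = cong suc ih
... | false | true = ih
... | false | false = ih

count-none : ∀ {n} (f : Fin n → Bool) → (∀ x → f x ≡ false) → ∣ tabulate f ∣ ≡ 0
count-none {zero} f none = refl
count-none {suc n} f none rewrite none Fin.zero = count-none (f ∘ Fin.suc) (none ∘ Fin.suc)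

count-one : ∀ {n} (f : Fin (suc n) → Bool) a → f a ≡ true → (∀ x → f x ≡ true → x ≡ a) →
  ∣ tabulate f ∣ ≡ 1
count-one f a fa only-a = trans (count-punchIn f a) (cong₂ _+_ (cong (λ b → if b then 1 else 0) fa)
  (count-none (f ∘ punchIn a) λ y → ¬-not λ fy → punchInᵢ≢i a y (only-a _ fy)))

count-two : ∀ {n} (f : Fin (suc (suc n)) → Bool) a b → f a ≡ true → f b ≡ true → a ≢ b →
  (∀ x → f x ≡ true → x ≡ a ⊎ x ≡ b) → ∣ tabulate f ∣ ≡ 2
count-two f a b fa fb a≢b only-ab = trans (count-punchIn f a) (cong₂ _+_ (cong (λ b → if b then 1 else 0) fa)
  (count-one (f ∘ punchIn a) (punchOut a≢b) (trans (cong f (punchIn-punchOut a≢b)) fb)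
    λ y fy → only-b y (only-ab _ fy)))
  where
  only-b : ∀ y → punchIn a y ≡ a ⊎ punchIn a y ≡ b → y ≡ punchOut a≢b
  only-b y (inj₁ e) = ⊥-elim (punchInᵢ≢i a y e)
  only-b y (inj₂ e) = FinP.punchIn-injective a _ _ (trans e (sym (punchIn-punchOut a≢b)))

record Extends {m} (i : Fin (suc m)) (ℓ : Vec (Fin (suc m)) (suc m)) (ℓ' : Vec (Fin m) m) : Set where
  field
    top-at  : lookup ℓ i ≡ fromℕ m
    rest-at : ∀ x → lookup ℓ (punchIn i x) ≡ inject₁ (lookup ℓ' x)
open Extends

extend : ∀ {m} → Fin (suc m) → Vec (Fin m) m → Vec (Fin (suc m)) (suc m)
extend {m} i ℓ' = insertAt (Vec.map inject₁ ℓ') i (fromℕ m)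

extend-extends : ∀ {m} (i : Fin (suc m)) ℓ' → Extends i (extend i ℓ') ℓ'
extend-extends {m} i ℓ' = record
  { top-at = insertAt-lookup (Vec.map inject₁ ℓ') i (fromℕ m)
  ; rest-at = λ x → trans (insertAt-punchIn (Vec.map inject₁ ℓ') i (fromℕ m) x) (lookup-map x inject₁ ℓ') }

module _ {m} {i : Fin (suc m)} {ℓ ℓ'} (E : Extends i ℓ ℓ') where

  below-top : ∀ w → w ≢ i → lookup ℓ w < lookup ℓ i
  below-top w w≢i with fin-split i w
  ... | inj₁ w≡i = ⊥-elim (w≢i w≡i)
  ... | inj₂ (y , refl) = subst₂ _<_ (sym (rest-at E y)) (sym (top-at E)) (inject₁<fromℕ (lookup ℓ' y))

  top-only-at-i : ∀ w → lookup ℓ w ≡ fromℕ m → w ≡ i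
  top-only-at-i w top with fin-split i w
  ... | inj₁ w≡i = w≡i
  ... | inj₂ (y , refl) = ⊥-elim (fromℕ≢inject₁ (trans (sym top) (rest-at E y)))

  rest-<⇔ : ∀ x y → lookup ℓ (punchIn i y) < lookup ℓ (punchIn i x) ⇔ lookup ℓ' y < lookup ℓ' x
  rest-<⇔ x y = subst₂ (λ p q → p < q ⇔ lookup ℓ' y < lookup ℓ' x) (sym (rest-at E y)) (sym (rest-at E x))
    (inject₁-<⇔ (lookup ℓ' y) (lookup ℓ' x))

  extends⇒≡extend : ℓ ≡ extend i ℓ'
  extends⇒≡extend = ≡-via-punchIn i (trans (top-at E) (sym (top-at E')))
    λ x → trans (rest-at E x) (sym (rest-at E' x))
    where E' = extend-extends i ℓ'

  extends-labeling : IsLabeling ℓ ⇔ IsLabeling ℓ'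
  extends-labeling = mk⇔ restrict-injective lift-injective
    where
    restrict-injective : IsLabeling ℓ → IsLabeling ℓ'
    restrict-injective ℓ-inj x y e = FinP.punchIn-injective i x y
      (ℓ-inj _ _ (trans (rest-at E x) (trans (cong inject₁ e) (sym (rest-at E y)))))

    not-top : ∀ y → lookup ℓ (punchIn i y) ≢ lookup ℓ i
    not-top y e = punchInᵢ≢i i y (top-only-at-i _ (trans e (top-at E)))

    lift-injective : IsLabeling ℓ' → IsLabeling ℓ
    lift-injective ℓ'-inj a b e with fin-split i a | fin-split i b
    ... | inj₁ refl | inj₁ refl = refl
    ... | inj₁ refl | inj₂ (y , refl) = ⊥-elim (not-top y (sym e))
    ... | inj₂ (y , refl) | inj₁ refl = ⊥-elim (not-top y e)
    ... | inj₂ (y , refl) | inj₂ (z , refl) = cong (punchIn i) (ℓ'-inj y z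
          (inject₁-injective (trans (sym (rest-at E y)) (trans e (rest-at E z)))))


extend-injective : ∀ {m} {i j : Fin (suc m)} {v w} → extend i v ≡ extend j w → i ≡ j × v ≡ w
extend-injective {i = i} {j} {v} {w} e with top-only-at-i (extend-extends j w) i
  (trans (cong (λ ℓ → lookup ℓ i) (sym e)) (top-at (extend-extends i v)))
... | refl = refl , ≡-via-lookup λ x → inject₁-injective
  (trans (sym (rest-at (extend-extends i v) x)) (trans (cong (λ ℓ → lookup ℓ (punchIn i x)) e)
    (rest-at (extend-extends i w) x)))

labeling-splits : ∀ {m} (ℓ : Vec (Fin (suc m)) (suc m)) → IsLabeling ℓ → ∃₂ λ i ℓ' → Extends i ℓ ℓ'
labeling-splits {m} ℓ ℓ-inj with injective⇒surjective (lookup ℓ) ℓ-inj (fromℕ m)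
... | i , top = i , tabulate restrict , record { top-at = top ; rest-at = rest }
  where
  not-top : ∀ x → m ≢ toℕ (lookup ℓ (punchIn i x))
  not-top x m≡ = punchInᵢ≢i i x (ℓ-inj _ _
    (trans (toℕ-injective (trans (sym m≡) (sym (toℕ-fromℕ m)))) (sym top)))
  restrict : Fin m → Fin m
  restrict x = lower₁ (lookup ℓ (punchIn i x)) (not-top x)
  rest : ∀ x → lookup ℓ (punchIn i x) ≡ inject₁ (lookup (tabulate restrict) x)
  rest x = sym (trans (cong inject₁ (lookup∘tabulate restrict x)) (inject₁-lower₁ _ (not-top x)))

TwoRegular : ∀ {N} → Graph N → Set
TwoRegular G = ∀ v → deg G v ≡ 2

Loopless : ∀ {N} → Graph N → Set
Loopless G = ∀ v → adj G v v ≡ false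

deg-deleteV : ∀ {m} (G : Graph (suc m)) i x →
  deg G (punchIn i x) ≡ (if adj G (punchIn i x) i then 1 else 0) + deg (deleteV G i) x
deg-deleteV G i x = count-punchIn (adj G (punchIn i x)) i

module TopDeletion {m} (G : Graph (suc m)) (regular : TwoRegular G) (loopless : Loopless G)
                   {i : Fin (suc m)} {ℓ ℓ'} (E : Extends i ℓ ℓ') where

  D : Graph m
  D = deleteV G i

  -- The vertex with the top label is a peak (degree 2, every neighbour is another vertex).
  top-is-peak : IsPeak G ℓ i
  top-is-peak = subst (2 ≤_) (sym (regular i)) ℕP.≤-refl ,
    λ w i~w → below-top E w λ { refl → contradiction (trans (sym i~w) (loopless i)) λ () }

  module _ (x : Fin m) where
    v : Fin (suc m)
    v = punchIn i x

    deg-if-adjacent : adj G v i ≡ true → deg D x ≡ 1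
    deg-if-adjacent v~i = sym (ℕP.suc-injective (trans (sym (regular v))
      (trans (deg-deleteV G i x) (cong (λ b → (if b then 1 else 0) + deg D x) v~i))))

    deg-if-not-adjacent : adj G v i ≡ false → deg G v ≡ deg D x
    deg-if-not-adjacent v≁i = trans (deg-deleteV G i x) (cong (λ b → (if b then 1 else 0) + deg D x) v≁i)

    -- A vertex v ≠ i is a peak of ℓ in G iff it is a peak of ℓ' in G \ {i}: if v is adjacent
    -- to i it is neither (it lies below i, resp. has degree 1), otherwise nothing changes.
    peak-restricts : IsPeak G ℓ v → IsPeak D ℓ' x
    peak-restricts (deg≥2 , higher) with adj G v i in v~i
    ... | true = ⊥-elim (FinP.<-asym (higher i v~i) (below-top E v (punchInᵢ≢i i x)))
    ... | false = subst (2 ≤_) (deg-if-not-adjacent v~i) deg≥2 ,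
                  λ y x~y → to (rest-<⇔ E x y) (higher (punchIn i y) x~y)

    peak-extends : IsPeak D ℓ' x → IsPeak G ℓ v
    peak-extends (deg≥2 , higher) with adj G v i in v~i
    ... | true = contradiction (subst (2 ≤_) (deg-if-adjacent v~i) deg≥2) λ { (s≤s ()) }
    ... | false = subst (2 ≤_) (sym (deg-if-not-adjacent v~i)) deg≥2 , higher-in-G
      where
      higher-in-G : ∀ w → adj G v w ≡ true → lookup ℓ w < lookup ℓ v
      higher-in-G w v~w with fin-split i w
      ... | inj₁ refl = contradiction (trans (sym v~w) v~i) λ ()
      ... | inj₂ (y , refl) = from (rest-<⇔ E x y) (higher y v~w)

  peakSet-top : lookup (peakSet G ℓ) i ≡ true
  peakSet-top = trans (lookup∘tabulate (λ w → ⌊ isPeak? G ℓ w ⌋) i) (⌊⌋-true (isPeak? G ℓ i) top-is-peak)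

  peakSet-rest : ∀ x → lookup (peakSet D ℓ') x ≡ lookup (peakSet G ℓ) (punchIn i x)
  peakSet-rest x = begin
    lookup (peakSet D ℓ') x                 ≡⟨ lookup∘tabulate (λ y → ⌊ isPeak? D ℓ' y ⌋) x ⟩
    ⌊ isPeak? D ℓ' x ⌋                      ≡⟨ ⌊⌋-⇔ (isPeak? D ℓ' x) (isPeak? G ℓ (punchIn i x))
                                                   (mk⇔ (peak-extends x) (peak-restricts x)) ⟩
    ⌊ isPeak? G ℓ (punchIn i x) ⌋           ≡⟨ lookup∘tabulate (λ w → ⌊ isPeak? G ℓ w ⌋) (punchIn i x) ⟨
    lookup (peakSet G ℓ) (punchIn i x)      ∎
    where open ≡-Reasoning

  peakSet-extends : ∀ S → peakSet G ℓ ≡ S ⇔ (lookup S i ≡ true × peakSet D ℓ' ≡ deleteS S i)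
  peakSet-extends S = mk⇔
    (λ { refl → peakSet-top , peakSet-deleted })
    (λ (S-i , rest) → ≡-via-punchIn i (trans peakSet-top (sym S-i)) λ x →
      trans (sym (peakSet-rest x)) (trans (cong (λ T → lookup T x) rest) (lookup∘tabulate _ x)))
    where
    peakSet-deleted : peakSet D ℓ' ≡ deleteS (peakSet G ℓ) i
    peakSet-deleted = ≡-via-lookup λ x →
      trans (peakSet-rest x) (sym (lookup∘tabulate (λ y → lookup (peakSet G ℓ) (punchIn i y)) x))

numP-twoRegular : ∀ {m} (G : Graph (suc m)) → TwoRegular G → Loopless G → (S : Subset (suc m)) →
  numP S G ≡ sumFin (suc m) (λ i → if lookup S i then numP (deleteS S i) (deleteV G i) else 0)
numP-twoRegular {m} G regular loopless S = begin
  length (filter (inP? S G) (allVecs (suc m)))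
    ≡⟨ count-image (inP? S G) Q? (allVecs-unique (suc m)) pairs! (allVecs-complete (suc m)) pairs-all
         (uncurry extend) (λ e → uncurry (cong₂ _,_) (extend-injective e)) Q⇒P P⇒Q ⟩
  length (filter Q? pairs)
    ≡⟨ count-cartesianProduct Q? (allFin (suc m)) (allVecs m) ⟩
  sum (map (λ i → length (filter (λ ℓ' → Q? (i , ℓ')) (allVecs m))) (allFin (suc m)))
    ≡⟨ cong sum (map-cong fibre (allFin (suc m))) ⟩
  sumFin (suc m) (λ i → if lookup S i then numP (deleteS S i) (deleteV G i) else 0)
    ∎
  where
  open ≡-Reasoning

  Q : Fin (suc m) × Vec (Fin m) m → Set
  Q (i , ℓ') = lookup S i ≡ true × InP (deleteS S i) (deleteV G i) ℓ'

  Q? : Decidable Q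
  Q? (i , ℓ') = (lookup S i ≟ true) ×-dec inP? (deleteS S i) (deleteV G i) ℓ'

  pairs : List (Fin (suc m) × Vec (Fin m) m)
  pairs = cartesianProduct (allFin (suc m)) (allVecs m)

  pairs! : Unique pairs
  pairs! = Unique.cartesianProduct⁺ (Unique.allFin⁺ (suc m)) (allVecs-unique m)

  pairs-all : ∀ p → p ∈ pairs
  pairs-all (i , ℓ') = ∈-cartesianProduct⁺ (∈-allFin i) (allVecs-complete m ℓ')

  peaks⇔ : ∀ {i ℓ ℓ'} → Extends i ℓ ℓ' →
    peakSet G ℓ ≡ S ⇔ (lookup S i ≡ true × peakSet (deleteV G i) ℓ' ≡ deleteS S i)
  peaks⇔ E = TopDeletion.peakSet-extends G regular loopless E S

  Q⇒P : ∀ {p} → Q p → InP S G (uncurry extend p)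
  Q⇒P {i , ℓ'} (S-i , ℓ'-lab , ℓ'-peaks) =
    from (extends-labeling E) ℓ'-lab , from (peaks⇔ E) (S-i , ℓ'-peaks)
    where E = extend-extends i ℓ'

  P⇒Q : ∀ {ℓ} → InP S G ℓ → ∃ λ p → Q p × uncurry extend p ≡ ℓ
  P⇒Q {ℓ} (ℓ-lab , ℓ-peaks) with labeling-splits ℓ ℓ-lab
  ... | i , ℓ' , E with to (peaks⇔ E) ℓ-peaks
  ... | S-i , ℓ'-peaks =
    (i , ℓ') , (S-i , to (extends-labeling E) ℓ-lab , ℓ'-peaks) , sym (extends⇒≡extend E)

  fibre : ∀ i → length (filter (λ ℓ' → Q? (i , ℓ')) (allVecs m))
              ≡ (if lookup S i then numP (deleteS S i) (deleteV G i) else 0)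
  fibre i = fibre-by (lookup S i) refl
    where
    fibre-by : ∀ b → lookup S i ≡ b → length (filter (λ ℓ' → Q? (i , ℓ')) (allVecs m))
                                      ≡ (if b then numP (deleteS S i) (deleteV G i) else 0)
    fibre-by true S-i = cong length (filter-≐ (λ ℓ' → Q? (i , ℓ')) (inP? (deleteS S i) (deleteV G i))
                          (proj₂ , (S-i ,_)) (allVecs m))
    fibre-by false S-i = cong length (filter-none (λ ℓ' → Q? (i , ℓ'))
                           (All.universal (λ _ q → contradiction (trans (sym (proj₁ q)) S-i) λ ()) (allVecs m)))

next : ∀ {m} → Fin (suc m) → Fin (suc m)
next {m} u = fromℕ< (m%n<n (suc (toℕ u)) (suc m))

NextCases : ∀ {m} → Fin (suc m) → Set
NextCases {m} u = toℕ (next u) ≡ suc (toℕ u) ⊎ (toℕ (next u) ≡ 0 × suc (toℕ u) ≡ suc m)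

toℕ-next : ∀ {m} (u : Fin (suc m)) → NextCases u
toℕ-next {m} u with ℕP.m≤n⇒m<n∨m≡n (toℕ<n u)
... | inj₁ step = inj₁ (trans (toℕ-fromℕ< _) (m<n⇒m%n≡m step))
... | inj₂ wrap = inj₂ (trans (toℕ-fromℕ< _) (trans (cong (_% suc m) wrap) (n%n≡0 (suc m))) , wrap)

next-spec : ∀ {m} (u w : Fin (suc m)) → (toℕ w ≡ suc (toℕ u) % suc m) ⇔ (w ≡ next u)
next-spec u w = mk⇔ (λ e → toℕ-injective (trans e (sym (toℕ-fromℕ< _))))
                    (λ { refl → toℕ-fromℕ< _ })

next-injective : ∀ {m} (u w : Fin (suc m)) → next u ≡ next w → u ≡ w
next-injective u w e = toℕ-injective (same (toℕ-next u) (toℕ-next w))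
  where
  e′ : toℕ (next u) ≡ toℕ (next w)
  e′ = cong toℕ e
  same : NextCases u → NextCases w → toℕ u ≡ toℕ w
  same (inj₁ su) (inj₁ sw) = ℕP.suc-injective (trans (sym su) (trans e′ sw))
  same (inj₁ su) (inj₂ (zw , _)) = contradiction (trans (sym su) (trans e′ zw)) ℕP.1+n≢0
  same (inj₂ (zu , _)) (inj₁ sw) = contradiction (trans (sym sw) (trans (sym e′) zu)) ℕP.1+n≢0
  same (inj₂ (_ , wu)) (inj₂ (_ , ww)) = ℕP.suc-injective (trans wu (sym ww))

next-no-fixpoint : ∀ {k} (u : Fin (suc (suc k))) → next u ≢ u
next-no-fixpoint {k} u e = cases (toℕ-next u)
  where
  e′ : toℕ (next u) ≡ toℕ u
  e′ = cong toℕ e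
  cases : NextCases u → ⊥
  cases (inj₁ su) = ℕP.1+n≢n (trans (sym su) e′)
  cases (inj₂ (zu , wrap)) = ℕP.1+n≢0 (sym (ℕP.suc-injective (trans (sym (cong suc (trans (sym e′) zu))) wrap)))

next²-no-fixpoint : ∀ {k} (u : Fin (suc (suc (suc k)))) → next (next u) ≢ u
next²-no-fixpoint u e = cases (toℕ-next u) (toℕ-next (next u))
  where
  e′ : toℕ (next (next u)) ≡ toℕ u
  e′ = cong toℕ e
  cases : NextCases u → NextCases (next u) → ⊥
  cases (inj₁ su) (inj₁ ssu) = ℕP.m≢1+n+m (toℕ u) {1} (trans (sym e′) (trans ssu (cong suc su)))
  cases (inj₁ su) (inj₂ (zu , wrap)) =
    ℕP.1+n≢0 (ℕP.suc-injective (ℕP.suc-injective (trans (sym wrap) (cong suc (trans su (cong suc (trans (sym e′) zu)))))))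
  cases (inj₂ (zu , wrap)) (inj₁ su) =
    ℕP.1+n≢0 (ℕP.suc-injective (ℕP.suc-injective (trans (sym wrap) (cong suc (trans (sym e′) (trans su (cong suc zu)))))))
  cases (inj₂ (zu , _)) (inj₂ (_ , wrap)) =
    ℕP.1+n≢0 (sym (ℕP.suc-injective (trans (cong suc (sym zu)) wrap)))

⌊⌋-∨-true : ∀ {A B : Set} (a? : Dec A) (b? : Dec B) → (⌊ a? ⌋ ∨ ⌊ b? ⌋ ≡ true) ⇔ (A ⊎ B)
⌊⌋-∨-true (yes a) _ = mk⇔ (λ _ → inj₁ a) (λ _ → refl)
⌊⌋-∨-true (no ¬a) (yes b) = mk⇔ (λ _ → inj₂ b) (λ _ → refl)
⌊⌋-∨-true (no ¬a) (no ¬b) = mk⇔ (λ ()) (⊥-elim ∘ Sum.[ ¬a , ¬b ])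

cycle-adj : ∀ {m} (u w : Fin (suc m)) → (adj (cycle m) u w ≡ true) ⇔ (w ≡ next u ⊎ u ≡ next w)
cycle-adj u w = mk⇔
  (Sum.map (to (next-spec u w)) (to (next-spec w u)) ∘ to (⌊⌋-∨-true (toℕ w ℕ.≟ _) (toℕ u ℕ.≟ _)))
  (from (⌊⌋-∨-true (toℕ w ℕ.≟ _) (toℕ u ℕ.≟ _)) ∘ Sum.map (from (next-spec u w)) (from (next-spec w u)))

-- A loop at u would make u its own successor.
cycle-loopless : ∀ {k} → Loopless (cycle (suc k))
cycle-loopless u = ¬-not λ u~u → Sum.[ no-fix , no-fix ] (to (cycle-adj u u) u~u)
  where
  no-fix : u ≡ next u → ⊥
  no-fix = next-no-fixpoint u ∘ sym

-- The two neighbours of u are next u and its unique predecessor, and they differ.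
cycle-2-regular : ∀ {k} → TwoRegular (cycle (suc (suc k)))
cycle-2-regular u with injective⇒surjective next next-injective u
... | prev , next-prev = count-two (adj (cycle _) u) (next u) prev
  (from (cycle-adj u _) (inj₁ refl)) (from (cycle-adj u _) (inj₂ (sym next-prev)))
  (λ e → next²-no-fixpoint u (trans (cong next e) next-prev))
  (λ w u~w → Sum.map id (λ e → next-injective w prev (trans (sym e) (sym next-prev))) (to (cycle-adj u w) u~w))

-- Proposition 2.1: C_n with n ≥ 3 is loopless and 2-regular.
proposition2p1 : (m : ℕ) → 3 ≤ suc m → (S : Subset (suc m)) → Admissible S (cycle m) →
    numP S (cycle m) ≡
      sumFin (suc m) (λ i → if lookup S i then numP (deleteS S i) (deleteV (cycle m) i) else 0)
proposition2p1 (suc (suc k)) (s≤s (s≤s (s≤s z≤n))) S _ =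
  numP-twoRegular (cycle (suc (suc k))) cycle-2-regular cycle-loopless S
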